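{- Let $(T=(N,F),X)$ be a tree decomposition of adhesion $2$ of a graph $G$ and let $t\in N$. Let $P_1$ and $P_2$ be two $X_t$-paths in $G$. If $P_1$ and $P_2$ share an internal vertex, then $P_1$ and $P_2$ have the same endpoints.
   Context: A tree decomposition $(T=(N,F),X)$ of $G=(V,E)$: a tree $T$ with bags $X_t\subseteq V$ such that every vertex is in some bag, every edge has both endpoints in a common bag, and the bags containing any vertex form a subtree. Its adhesion is the maximum over adjacent nodes $t,t'\in N$ of $|X_t\cap X_{t'}|$. For $W\subseteq V$, a $W$-path is a path between two vertices $x,y\in W$ whose vertex set meets $W$ only in $\{x,y\}$. -}

module Defs where

open import Data.Nat using (ℕ; _≤_)
open import Data.Fin using (Fin)
open import Data.Fin.Subset using (Subset; _∩_; ∣_∣) renaming (_∈_ to _∈ₛ_)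
open import Data.List using (List; []; _∷_; length)
open import Data.List.Membership.Propositional using () renaming (_∈_ to _∈ₗ_)
open import Data.List.Relation.Unary.All using (All)
open import Data.List.Relation.Unary.Linked using (Linked)
open import Data.List.Relation.Unary.Unique.Propositional using (Unique)
open import Data.Product using (Σ; ∃; _×_; proj₁)
open import Data.Sum using (_⊎_)
open import Data.Empty using (⊥)
open import Relation.Nullary using (¬_)
open import Relation.Binary.PropositionalEquality using (_≡_)

record Graph (V : Set) : Set₁ where
  field
    Adj    : V → V → Set
    sym    : ∀ {x y} → Adj x y → Adj y x
    irrefl : ∀ {x} → ¬ Adj x x

lastOf : {A : Set} → A → List A → A
lastOf x []       = x
lastOf _ (y ∷ ys) = lastOf y ys

dropLast : {A : Set} → List A → List A
dropLast []           = []
dropLast (x ∷ [])     = []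
dropLast (x ∷ y ∷ ys) = x ∷ dropLast (y ∷ ys)

record Path {V : Set} (G : Graph V) : Set where
  field
    first  : V
    rest   : List V
    linked : Linked (Graph.Adj G) (first ∷ rest)
    unique : Unique (first ∷ rest)

  verts : List V
  verts = first ∷ rest

  end : V
  end = lastOf first rest

  internal : List V
  internal = dropLast rest

open Path public

PathBetween : {V : Set} (G : Graph V) → V → V → Set
PathBetween G a b = Σ (Path G) λ P → first P ≡ a × end P ≡ b

Connected : {V : Set} → Graph V → Set
Connected {V} G = (a b : V) → PathBetween G a b

-- no cycle: no path with ≥ 3 vertices whose end is adjacent to its start
Acyclic : {V : Set} → Graph V → Set
Acyclic G = (P : Path G) → 2 ≤ length (rest P) → ¬ Graph.Adj G (end P) (first P)

IsTree : {V : Set} → Graph V → Set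
IsTree G = Connected G × Acyclic G

record TreeDecomposition {n m : ℕ} (G : Graph (Fin n)) (T : Graph (Fin m)) : Set where
  field
    isTree  : IsTree T
    bag     : Fin m → Subset n
    cover   : (v : Fin n) → ∃ λ t → v ∈ₛ bag t
    edge    : (u v : Fin n) → Graph.Adj G u v → ∃ λ t → (u ∈ₛ bag t) × (v ∈ₛ bag t)
    subtree : (v : Fin n) (t₁ t₂ : Fin m) → v ∈ₛ bag t₁ → v ∈ₛ bag t₂ →
              Σ (PathBetween T t₁ t₂) λ P → All (λ s → v ∈ₛ bag s) (verts (proj₁ P))

AdhesionAtMost : {n m : ℕ} {G : Graph (Fin n)} {T : Graph (Fin m)} →
                 TreeDecomposition G T → ℕ → Set
AdhesionAtMost {T = T} D k =
  ∀ t t' → Graph.Adj T t t' → ∣ TreeDecomposition.bag D t ∩ TreeDecomposition.bag D t' ∣ ≤ k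

IsWPath : {n : ℕ} {G : Graph (Fin n)} → Subset n → Path G → Set
IsWPath W P =
  (first P ∈ₛ W) × (end P ∈ₛ W) ×
  (∀ v → v ∈ₗ verts P → v ∈ₛ W → (v ≡ first P) ⊎ (v ≡ end P))

SameEndpoints : {V : Set} {G : Graph V} → Path G → Path G → Set
SameEndpoints P Q =
  (first P ≡ first Q × end P ≡ end Q) ⊎ (first P ≡ end Q × end P ≡ first Q)

-- A vertex u outside X t lives beyond exactly one neighbour t₁ of t: the one
-- whose branch of T − t contains the bags of u (these bags form a subtree avoiding t, and two
-- neighbours of t joined in T − t would close a cycle). The interior of an X t-path is connected
-- in G − X t, so it lies beyond a single t₁, and both endpoints, adjacent to interior vertices,
-- lie in X t ∩ X t₁. By adhesion 2 that set is exactly the endpoint pair. A shared internal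
-- vertex forces both paths to use the same t₁, hence the same endpoint pair.
module Submission where

open import Defs
open import Data.Nat using (ℕ; _≤_; z≤n; s≤s)
open import Data.Nat.Properties using (≤-trans)
open import Data.Fin using (Fin)
open import Data.Fin.Properties using (_≟_)
open import Data.Fin.Subset using (Subset; _-_; ∣_∣) renaming (_∈_ to _∈ₛ_; _∉_ to _∉ₛ_)
open import Data.Fin.Subset.Properties using (x∈p∩q⁺; x∈p⇒∣p-x∣<∣p∣; x∈p∧x≢y⇒x∈p-y)
open import Data.Product using (Σ; ∃; _×_; _,_; proj₁; proj₂)
open import Data.Sum using (_⊎_; inj₁; inj₂)
open import Data.Empty using (⊥-elim)
open import Data.List using ([]; _∷_)
open import Data.List.Membership.Propositional using (_∈_)
open import Data.List.Relation.Unary.Any using (here; there)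
open import Data.List.Relation.Unary.All as All using (All; []; _∷_)
open import Data.List.Relation.Unary.All.Properties using (¬Any⇒All¬)
open import Data.List.Relation.Unary.Linked using (Linked; []; [-]; _∷_)
open import Data.List.Relation.Unary.AllPairs using ([]; _∷_)
open import Data.List.Relation.Unary.Unique.Propositional using (Unique)
open import Relation.Nullary using (yes; no)
open import Relation.Binary.Definitions using (DecidableEquality)
open import Relation.Binary.PropositionalEquality using (_≡_; _≢_; ≢-sym; refl; sym; trans; subst)

module _ {A : Set} where

  dropLast-⊆ : ∀ {v : A} xs → v ∈ dropLast xs → v ∈ xs
  dropLast-⊆ (x ∷ y ∷ ys) (here v≡x) = here v≡x
  dropLast-⊆ (x ∷ y ∷ ys) (there v∈) = there (dropLast-⊆ (y ∷ ys) v∈)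

  lastOf-∈ : ∀ (x : A) xs → lastOf x xs ∈ x ∷ xs
  lastOf-∈ x []       = here refl
  lastOf-∈ x (y ∷ ys) = there (lastOf-∈ y ys)

  Unique-dropLast-≢-lastOf : ∀ {v} (x : A) xs → Unique (x ∷ xs) → v ∈ dropLast xs → v ≢ lastOf x xs
  Unique-dropLast-≢-lastOf x (y ∷ z ∷ zs) (_ ∷ y∉ ∷ _) (here refl) = All.lookup y∉ (lastOf-∈ z zs)
  Unique-dropLast-≢-lastOf x (y ∷ z ∷ zs) (_ ∷ u)      (there v∈)  = Unique-dropLast-≢-lastOf y (z ∷ zs) u v∈

  module _ {R : A → A → Set} where

    Linked-dropLast : ∀ {xs} → Linked R xs → Linked R (dropLast xs)
    Linked-dropLast []            = []
    Linked-dropLast [-]           = []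
    Linked-dropLast (r ∷ [-])     = [-]
    Linked-dropLast (r ∷ r′ ∷ rs) = r ∷ Linked-dropLast (r′ ∷ rs)

    Linked-lastOf-dropLast : ∀ x y ys → Linked R (x ∷ y ∷ ys) → R (lastOf x (dropLast (y ∷ ys))) (lastOf y ys)
    Linked-lastOf-dropLast x y []       (r ∷ _) = r
    Linked-lastOf-dropLast x y (z ∷ zs) (_ ∷ l) = Linked-lastOf-dropLast y z zs l

module _ {n} {p : Subset n} {x y : Fin n} (x∈p : x ∈ₛ p) (y∈p : y ∈ₛ p) (x≢y : x ≢ y) where

  ∣p∣≥3 : ∀ {z} → z ∈ₛ p → z ≢ x → z ≢ y → 3 ≤ ∣ p ∣
  ∣p∣≥3 z∈p z≢x z≢y =
    ≤-trans (s≤s (≤-trans (s≤s (≤-trans (s≤s z≤n) (x∈p⇒∣p-x∣<∣p∣ z∈p-x-y)))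
                         (x∈p⇒∣p-x∣<∣p∣ y∈p-x)))
            (x∈p⇒∣p-x∣<∣p∣ x∈p)
    where
    y∈p-x   = x∈p∧x≢y⇒x∈p-y y∈p (≢-sym x≢y)
    z∈p-x-y = x∈p∧x≢y⇒x∈p-y (x∈p∧x≢y⇒x∈p-y z∈p z≢x) z≢y

  ∣p∣≤2⇒≡⊎≡ : ∣ p ∣ ≤ 2 → ∀ {z} → z ∈ₛ p → z ≡ x ⊎ z ≡ y
  ∣p∣≤2⇒≡⊎≡ ∣p∣≤2 {z} z∈p with z ≟ x | z ≟ y
  ... | yes z≡x | _       = inj₁ z≡x
  ... | no _    | yes z≡y = inj₂ z≡y
  ... | no z≢x  | no z≢y  with ≤-trans (∣p∣≥3 z∈p z≢x z≢y) ∣p∣≤2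
  ...   | s≤s (s≤s ())

module _ {V : Set} {G : Graph V} {Pr : V → Set} where

  suffixPath : ∀ {x} (P : Path G) → x ∈ verts P → All Pr (verts P) →
               Σ (PathBetween G x (end P)) λ (Q , _) → All Pr (verts Q)
  suffixPath P (here refl) prs = (P , refl , refl) , prs
  suffixPath record { rest = y ∷ ys ; linked = _ ∷ l ; unique = _ ∷ u } (there x∈) (_ ∷ prs) =
    suffixPath record { first = y ; rest = ys ; linked = l ; unique = u } x∈ prs

module Branches {V : Set} (_≟ᵥ_ : DecidableEquality V) (T : Graph V) (T-tree : IsTree T) (t : V) where

  open Graph T using (Adj)
  open import Data.List.Membership.DecPropositional _≟ᵥ_ using (_∈?_)

  data Walk : V → V → Set where
    [_]  : ∀ {x} → x ≢ t → Walk x x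
    step : ∀ {x y z} → x ≢ t → Adj x y → Walk y z → Walk x z

  AvoidingPath : V → V → Set
  AvoidingPath x y = Σ (PathBetween T x y) λ (P , _) → All (_≢ t) (verts P)

  _∷ʳ_ : ∀ {x y z} → Walk x y → Adj y z × z ≢ t → Walk x z
  [ x≢t ]      ∷ʳ (a , z≢t) = step x≢t a [ z≢t ]
  step x≢t a w ∷ʳ e         = step x≢t a (w ∷ʳ e)

  reverse : ∀ {x y} → Walk x y → Walk y x
  reverse [ x≢t ]        = [ x≢t ]
  reverse (step x≢t a w) = reverse w ∷ʳ (Graph.sym T a , x≢t)

  _++_ : ∀ {x y z} → Walk x y → Walk y z → Walk x z
  [ _ ]        ++ w′ = w′
  step x≢t a w ++ w′ = step x≢t a (w ++ w′)

  path⇒walk : (P : Path T) → All (_≢ t) (verts P) → Walk (first P) (end P)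
  path⇒walk record { rest = [] } (x≢t ∷ _) = [ x≢t ]
  path⇒walk record { rest = y ∷ ys ; linked = a ∷ l ; unique = _ ∷ u } (x≢t ∷ ≢s) =
    step x≢t a (path⇒walk record { first = y ; rest = ys ; linked = l ; unique = u } ≢s)

  walk⇒path : ∀ {x y} → Walk x y → AvoidingPath x y
  walk⇒path [ x≢t ] = (record { first = _ ; rest = [] ; linked = [-] ; unique = [] ∷ [] } , refl , refl) , x≢t ∷ []
  walk⇒path {x} (step x≢t a w) with walk⇒path w
  ... | (P , refl , refl) , ≢s with x ∈? verts P
  ...   | yes x∈P = suffixPath P x∈P ≢s
  ...   | no  x∉P = (record { first = x ; rest = verts P ; linked = a ∷ linked P
                            ; unique = ¬Any⇒All¬ (verts P) x∉P ∷ unique P } , refl , refl) , x≢t ∷ ≢s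

  -- A path in T − t joining two neighbours of t closes a cycle through t.
  neighbours-joined⇒≡ : ∀ {t₁ t₂} → Adj t t₁ → Adj t t₂ → AvoidingPath t₁ t₂ → t₁ ≡ t₂
  neighbours-joined⇒≡ a₁ a₂ ((record { rest = [] } , refl , e) , _) = e
  neighbours-joined⇒≡ a₁ a₂ ((Q@record { rest = _ ∷ _ } , refl , refl) , ≢s) =
    ⊥-elim (proj₂ T-tree cycle (s≤s (s≤s z≤n)) (Graph.sym T a₂))
    where
    cycle : Path T
    cycle = record { first = t ; rest = verts Q ; linked = a₁ ∷ linked Q
                   ; unique = All.map ≢-sym ≢s ∷ unique Q }

  -- The node s lies in the component of T − t containing the neighbour t₁ of t.
  InBranch : V → V → Set
  InBranch t₁ s = Adj t t₁ × Walk t₁ s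

  inBranch-unique : ∀ {s t₁ t₂} → InBranch t₁ s → InBranch t₂ s → t₁ ≡ t₂
  inBranch-unique (a₁ , w₁) (a₂ , w₂) = neighbours-joined⇒≡ a₁ a₂ (walk⇒path (w₁ ++ reverse w₂))

  inBranch-≢t : ∀ {t₁ s} → InBranch t₁ s → s ≢ t
  inBranch-≢t (_ , w) = target≢t w
    where
    target≢t : ∀ {x y} → Walk x y → y ≢ t
    target≢t [ y≢t ]      = y≢t
    target≢t (step _ _ w) = target≢t w

  inBranch-extend : ∀ {s s′ t₁} → InBranch t₁ s → (P : Path T) → first P ≡ s → end P ≡ s′ →
                    All (_≢ t) (verts P) → InBranch t₁ s′
  inBranch-extend (a , w) P refl refl ≢s = a , w ++ path⇒walk P ≢s

  inBranch-of-path-from : ∀ {s} (P : Path T) → first P ≡ t → end P ≡ s → s ≢ t →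
                          ∃ λ t₁ → t₁ ∈ verts P × InBranch t₁ s
  inBranch-of-path-from record { rest = [] } refl refl s≢t = ⊥-elim (s≢t refl)
  inBranch-of-path-from record { rest = t₁ ∷ r ; linked = a ∷ l ; unique = t∉ ∷ u } refl refl _ =
    t₁ , there (here refl) , a ,
    path⇒walk record { first = t₁ ; rest = r ; linked = l ; unique = u } (All.map ≢-sym t∉)

  inBranch-exists : ∀ {s} → s ≢ t → ∃ λ t₁ → InBranch t₁ s
  inBranch-exists {s} s≢t with proj₁ T-tree t s
  ... | P , P-from , P-to with inBranch-of-path-from P P-from P-to s≢t
  ...   | t₁ , _ , b = t₁ , b

module _ {n} {G : Graph (Fin n)} where

  internal⇒first≢end : ∀ {v} (P : Path G) → v ∈ internal P → first P ≢ end P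
  internal⇒first≢end record { rest = y ∷ ys ; unique = first∉ ∷ _ } _ = All.lookup first∉ (lastOf-∈ y ys)

  WPath-internal-∉ : ∀ {W v} (P : Path G) → IsWPath W P → v ∈ internal P → v ∉ₛ W
  WPath-internal-∉ {v = v} P@record { first = x ; rest = xs ; unique = u@(x∉ ∷ _) } (_ , _ , onlyEnds) v∈ v∈W
    with onlyEnds v (there (dropLast-⊆ xs v∈)) v∈W
  ... | inj₁ v≡x = All.lookup x∉ (dropLast-⊆ xs v∈) (sym v≡x)
  ... | inj₂ v≡y = Unique-dropLast-≢-lastOf x xs u v∈ v≡y

  ≡⊎≡⇒SameEndpoints : ∀ (P Q : Path G) → first Q ≡ first P ⊎ first Q ≡ end P →
                      end Q ≡ first P ⊎ end Q ≡ end P → first Q ≢ end Q → SameEndpoints P Q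
  ≡⊎≡⇒SameEndpoints _ _ (inj₁ q≡p) (inj₂ q′≡p′) _   = inj₁ (sym q≡p , sym q′≡p′)
  ≡⊎≡⇒SameEndpoints _ _ (inj₂ q≡p′) (inj₁ q′≡p) _   = inj₂ (sym q′≡p , sym q≡p′)
  ≡⊎≡⇒SameEndpoints _ _ (inj₁ q≡p) (inj₁ q′≡p) q≢q′ = ⊥-elim (q≢q′ (trans q≡p (sym q′≡p)))
  ≡⊎≡⇒SameEndpoints _ _ (inj₂ q≡p) (inj₂ q′≡p) q≢q′ = ⊥-elim (q≢q′ (trans q≡p (sym q′≡p)))

module AtNode {n m} {G : Graph (Fin n)} {T : Graph (Fin m)} (D : TreeDecomposition G T) (t : Fin m) where

  open TreeDecomposition D
  open Branches _≟_ T isTree t public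
  open Graph G using (Adj)

  bag-inBranch : ∀ {x s t₁} → x ∈ₛ bag t → x ∈ₛ bag s → InBranch t₁ s → x ∈ₛ bag t₁
  bag-inBranch {x} {s} x∈t x∈s b with subtree x t s x∈t x∈s
  ... | (P , P-from , P-to) , x∈Ps with inBranch-of-path-from P P-from P-to (inBranch-≢t b)
  ...   | t₁′ , t₁′∈P , b′ = subst (λ q → x ∈ₛ bag q) (inBranch-unique b′ b) (All.lookup x∈Ps t₁′∈P)

  LivesBeyond : Fin n → Fin m → Set
  LivesBeyond u t₁ = ∃ λ s → u ∈ₛ bag s × InBranch t₁ s

  ∉bag⇒≢ : ∀ {u s} → u ∉ₛ bag t → u ∈ₛ bag s → s ≢ t
  ∉bag⇒≢ u∉ u∈ refl = u∉ u∈

  livesBeyond-unique : ∀ {u t₁ t₂} → u ∉ₛ bag t → LivesBeyond u t₁ → LivesBeyond u t₂ → t₁ ≡ t₂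
  livesBeyond-unique {u} u∉ (s , u∈s , b₁) (s′ , u∈s′ , b₂) with subtree u s s′ u∈s u∈s′
  ... | (P , P-from , P-to) , u∈Ps =
    inBranch-unique (inBranch-extend b₁ P P-from P-to (All.map (∉bag⇒≢ u∉) u∈Ps)) b₂

  livesBeyond-exists : ∀ {u} → u ∉ₛ bag t → ∃ (LivesBeyond u)
  livesBeyond-exists {u} u∉ with cover u
  ... | s , u∈s with inBranch-exists (∉bag⇒≢ u∉ u∈s)
  ...   | t₁ , b = t₁ , s , u∈s , b

  livesBeyond-adj : ∀ {u w t₁} → Adj u w → u ∉ₛ bag t → w ∉ₛ bag t → LivesBeyond w t₁ → LivesBeyond u t₁
  livesBeyond-adj {u} {w} a u∉ w∉ β with edge u w a
  ... | s , u∈s , w∈s with inBranch-exists (∉bag⇒≢ u∉ u∈s)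
  ...   | t₂ , b = s , u∈s , subst (λ q → InBranch q s) (livesBeyond-unique w∉ (s , w∈s , b) β) b

  bag-adj-livesBeyond : ∀ {x u t₁} → Adj x u → x ∈ₛ bag t → u ∉ₛ bag t → LivesBeyond u t₁ → x ∈ₛ bag t₁
  bag-adj-livesBeyond {x} {u} a x∈t u∉ β with edge x u a
  ... | s , x∈s , u∈s with inBranch-exists (∉bag⇒≢ u∉ u∈s)
  ...   | t₂ , b = subst (λ q → x ∈ₛ bag q) (livesBeyond-unique u∉ (s , u∈s , b) β) (bag-inBranch x∈t x∈s b)

  Linked-livesBeyond : ∀ {u} us → Linked Adj (u ∷ us) → All (_∉ₛ bag t) (u ∷ us) →
                       ∃ λ t₁ → All (λ y → LivesBeyond y t₁) (u ∷ us)
  Linked-livesBeyond [] _ (u∉ ∷ []) with livesBeyond-exists u∉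
  ... | t₁ , β = t₁ , β ∷ []
  Linked-livesBeyond (w ∷ ws) (a ∷ l) (u∉ ∷ ∉s@(w∉ ∷ _)) with Linked-livesBeyond ws l ∉s
  ... | t₁ , βs@(β ∷ _) = t₁ , livesBeyond-adj a u∉ w∉ β ∷ βs

  WPath-livesBeyond : ∀ {v} (P : Path G) → IsWPath (bag t) P → v ∈ internal P →
                      ∃ λ t₁ → LivesBeyond v t₁ × first P ∈ₛ bag t₁ × end P ∈ₛ bag t₁
  WPath-livesBeyond P@record { rest = y ∷ z ∷ zs ; linked = x~y ∷ l } wp@(x∈ , x′∈ , _) v∈
    with Linked-livesBeyond (dropLast (z ∷ zs)) (Linked-dropLast l) (All.tabulate (WPath-internal-∉ P wp))
  ... | t₁ , βs = t₁ , All.lookup βs v∈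
                , bag-adj-livesBeyond x~y x∈ (WPath-internal-∉ P wp (here refl)) (All.head βs)
                , bag-adj-livesBeyond (Graph.sym G (Linked-lastOf-dropLast y z zs l)) x′∈
                                      (WPath-internal-∉ P wp last∈) (All.lookup βs last∈)
    where
    last∈ = lastOf-∈ y (dropLast (z ∷ zs))

  WPaths-meeting⇒common-neighbour-bag : ∀ {v} (P₁ P₂ : Path G) → IsWPath (bag t) P₁ → IsWPath (bag t) P₂ →
    v ∈ internal P₁ → v ∈ internal P₂ →
    ∃ λ t₁ → Graph.Adj T t t₁ ×
             first P₁ ∈ₛ bag t₁ × end P₁ ∈ₛ bag t₁ × first P₂ ∈ₛ bag t₁ × end P₂ ∈ₛ bag t₁
  WPaths-meeting⇒common-neighbour-bag P₁ P₂ wp₁ wp₂ v∈P₁ v∈P₂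
    with WPath-livesBeyond P₁ wp₁ v∈P₁ | WPath-livesBeyond P₂ wp₂ v∈P₂
  ... | t₁ , β₁@(_ , _ , t~t₁ , _) , a∈ , b∈ | t₂ , β₂ , c∈ , d∈
    with livesBeyond-unique (WPath-internal-∉ P₁ wp₁ v∈P₁) β₁ β₂
  ...   | refl = t₁ , t~t₁ , a∈ , b∈ , c∈ , d∈

proposition8 : {n m : ℕ} (G : Graph (Fin n)) (T : Graph (Fin m))
    (D : TreeDecomposition G T) → AdhesionAtMost D 2 →
    (t : Fin m) (P₁ P₂ : Path G) →
    IsWPath (TreeDecomposition.bag D t) P₁ →
    IsWPath (TreeDecomposition.bag D t) P₂ →
    (∃ λ v → v ∈ internal P₁ × v ∈ internal P₂) →
    SameEndpoints P₁ P₂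
proposition8 G T D adhesion≤2 t P₁ P₂ wp₁@(a∈t , b∈t , _) wp₂@(c∈t , d∈t , _) (_ , v∈P₁ , v∈P₂)
  with AtNode.WPaths-meeting⇒common-neighbour-bag D t P₁ P₂ wp₁ wp₂ v∈P₁ v∈P₂
... | t₁ , t~t₁ , a∈t₁ , b∈t₁ , c∈t₁ , d∈t₁ =
  ≡⊎≡⇒SameEndpoints P₁ P₂ (endpoint-of-P₁ c∈t c∈t₁) (endpoint-of-P₁ d∈t d∈t₁) (internal⇒first≢end P₂ v∈P₂)
  where
  bag = TreeDecomposition.bag D
  endpoint-of-P₁ : ∀ {x} → x ∈ₛ bag t → x ∈ₛ bag t₁ → x ≡ first P₁ ⊎ x ≡ end P₁
  endpoint-of-P₁ x∈t x∈t₁ =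
    ∣p∣≤2⇒≡⊎≡ (x∈p∩q⁺ (a∈t , a∈t₁)) (x∈p∩q⁺ (b∈t , b∈t₁)) (internal⇒first≢end P₁ v∈P₁)
              (adhesion≤2 t t₁ t~t₁) (x∈p∩q⁺ (x∈t , x∈t₁))
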